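{- Consider the synchronization pattern with $n\in\mathbb{N}$ clients and let $m$ be a marking of $\textit{compose}(\{C_1,\dots,C_n,S\})$ satisfying: (1) $m(i)+m(p)+m(q)+m(r)=1$; (2) for all $j\in\{1,\dots,n\}$, $m(i_j)+m(p_j)+m(q_j)+m(r_j)=1$; (3) $\sum_{j=1}^n m(p_j)=m(a_1)+m(p)+m(a_2)$; (4) $\sum_{k=1}^n m(q_k)+m(a_2)\le 1$; (5) $m(a_2)+m(a_3)\le 1$ and $m(a_2)+m(a_3)=m(q)-\sum_{k=1}^n m(q_k)$. Then for every transition enabled at $m$, the marking obtained by firing it again satisfies (1)–(5).
   Context: Petri nets: ${}^\bullet x$ and $x^\bullet$ denote pre- and postset; markings are functions from places to $\mathbb{N}$; a transition is enabled iff each place of its preset holds a token, and firing removes one token from each preset place and adds one to each postset place. Composing OPNs takes the union of all places, transitions and arcs, shared places being identified. Synchronization pattern with $n$ clients: a server OPN $S$ with internal places $i,p,q,r$, input places $a_1,a_3$, output place $a_2$, and transitions $u,v,w,t$ with ${}^\bullet u=\{i,a_1\}$, $u^\bullet=\{p\}$; ${}^\bullet v=\{p\}$, $v^\bullet=\{q,a_2\}$; ${}^\bullet w=\{q,a_3\}$, $w^\bullet=\{r\}$; ${}^\bullet t=\{r\}$, $t^\bullet=\{i\}$. For $1\le j\le n$, a client OPN $C_j$ with internal places $i_j,p_j,q_j,r_j$, input place $a_2$, output places $a_1,a_3$, and transitions $u_j,v_j,w_j$ with ${}^\bullet u_j=\{i_j\}$, $u_j^\bullet=\{p_j,a_1\}$;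 ${}^\bullet v_j=\{p_j,a_2\}$, $v_j^\bullet=\{q_j\}$; ${}^\bullet w_j=\{q_j\}$, $w_j^\bullet=\{r_j,a_3\}$. All clients and the server share the places $a_1,a_2,a_3$ and are otherwise disjoint; the places of the composition are $i,p,q,r,a_1,a_2,a_3$ and $i_j,p_j,q_j,r_j$ for $1\le j\le n$. -}

module Defs where

open import Data.Nat using (ℕ; zero; suc; _+_; _∸_; _≤_)
open import Data.Fin using (Fin; zero; suc; _≟_)
open import Data.Bool using (Bool; true; false; if_then_else_; _∨_)
open import Relation.Nullary.Decidable using (⌊_⌋)
open import Relation.Binary.PropositionalEquality using (_≡_)

-- Places of compose({C_1,…,C_n,S}): server places, shared places,
-- and the internal places i_j,p_j,q_j,r_j of each client j (j : Fin n).
data Place (n : ℕ) : Set where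
  i p q r a₁ a₂ a₃ : Place n
  iₓ pₓ qₓ rₓ : Fin n → Place n

data Transition (n : ℕ) : Set where
  u v w t : Transition n
  uₓ vₓ wₓ : Fin n → Transition n

_==_ : {n : ℕ} → Fin n → Fin n → Bool
j == k = ⌊ j ≟ k ⌋

pre : {n : ℕ} → Transition n → Place n → Bool
pre u i = true
pre u a₁ = true
pre v p = true
pre w q = true
pre w a₃ = true
pre t r = true
pre (uₓ j) (iₓ k) = j == k
pre (vₓ j) (pₓ k) = j == k
pre (vₓ j) a₂ = true
pre (wₓ j) (qₓ k) = j == k
pre _ _ = false

post : {n : ℕ} → Transition n → Place n → Bool
post u p = true
post v q = true
post v a₂ = true
post w r = true
post t i = true
post (uₓ j) (pₓ k) = j == k
post (uₓ j) a₁ = true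
post (vₓ j) (qₓ k) = j == k
post (wₓ j) (rₓ k) = j == k
post (wₓ j) a₃ = true
post _ _ = false

Marking : ℕ → Set
Marking n = Place n → ℕ

Enabled : {n : ℕ} → Marking n → Transition n → Set
Enabled m tr = ∀ x → pre tr x ≡ true → 1 ≤ m x

fire : {n : ℕ} → Marking n → Transition n → Marking n
fire m tr x = (m x ∸ (if pre tr x then 1 else 0)) + (if post tr x then 1 else 0)

∑ : {n : ℕ} → (Fin n → ℕ) → ℕ
∑ {zero} f = 0
∑ {suc n} f = f zero + ∑ (λ j → f (suc j))

-- In (5) the ℕ-subtraction-free form
-- m(a2)+m(a3) = m(q) - Σ m(q_k)  is written as  m(a2)+m(a3)+Σ m(q_k) = m(q)
-- (equivalent over the integers; avoids truncated subtraction).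
record Inv {n : ℕ} (m : Marking n) : Set where
  field
    inv1 : m i + m p + m q + m r ≡ 1
    inv2 : ∀ j → m (iₓ j) + m (pₓ j) + m (qₓ j) + m (rₓ j) ≡ 1
    inv3 : ∑ (λ j → m (pₓ j)) ≡ m a₁ + m p + m a₂
    inv4 : ∑ (λ k → m (qₓ k)) + m a₂ ≤ 1
    inv5a : m a₂ + m a₃ ≤ 1
    inv5b : m a₂ + m a₃ + ∑ (λ k → m (qₓ k)) ≡ m q

{-# OPTIONS --safe #-}
-- Firing an enabled transition changes each place by (tokens produced) − (tokens consumed), so an
-- additive functional L of the marking changes by L(produced) − L(consumed), and an equation L = R
-- between additive functionals survives every transition that changes both sides by the same amount.
-- Conditions (1), (2), (3) and the equation in (5) are such place invariants, checked transition by
-- transition; for the client sums this uses that a client transition touches exactly one client.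
-- The inequalities (4) and (5) then come for free: m(a₂) + m(a₃) + Σ m(q_k) = m(q) ≤ 1 by (5) and (1).
module Submission where

open import Defs
open import Data.Nat using (ℕ; zero; suc; _+_; _∸_; _≤_; z≤n)
open import Data.Nat.Properties
  using (+-0-commutativeMonoid; +-commutativeSemigroup; +-assoc; +-comm; +-cancelʳ-≡;
         +-identityʳ; m∸n+n≡m; m≤m+n; m≤n+m; +-monoˡ-≤; ≤-trans; module ≤-Reasoning)
open import Data.Fin using (Fin; zero; suc; _≟_)
open import Data.Bool using (true; false; if_then_else_)
open import Relation.Binary.PropositionalEquality
  using (_≡_; _≗_; refl; sym; trans; cong; cong₂; module ≡-Reasoning)
open import Relation.Nullary.Decidable using (⌊⌋-map′)
open import Algebra.Properties.CommutativeMonoid.Sum +-0-commutativeMonoid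
  using (sum; sum-cong-≗; ∑-distrib-+; sum-replicate-zero)
open import Algebra.Properties.CommutativeSemigroup +-commutativeSemigroup
  using (xy∙z≈xz∙y; x∙yz≈y∙xz; x∙yz≈yx∙z; interchange)

variable
  n : ℕ
  m : Marking n
  L R : Marking n → ℕ

∑≡sum : (f : Fin n → ℕ) → ∑ f ≡ sum f
∑≡sum {zero} f = refl
∑≡sum {suc n} f = cong (f zero +_) (∑≡sum (λ j → f (suc j)))

∑-cong : {f g : Fin n → ℕ} → f ≗ g → ∑ f ≡ ∑ g
∑-cong {f = f} {g} f≗g = trans (∑≡sum f) (trans (sum-cong-≗ f≗g) (sym (∑≡sum g)))

∑-+ : (f g : Fin n → ℕ) → ∑ (λ j → f j + g j) ≡ ∑ f + ∑ g
∑-+ f g = trans (∑≡sum (λ j → f j + g j))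
  (trans (∑-distrib-+ f g) (sym (cong₂ _+_ (∑≡sum f) (∑≡sum g))))

∑-zero : ∑ {n} (λ _ → 0) ≡ 0
∑-zero {n} = trans (∑≡sum {n} (λ _ → 0)) (sum-replicate-zero n)

∑-single : (j : Fin n) → ∑ (λ k → if j == k then 1 else 0) ≡ 1
∑-single {suc n} zero = cong suc (∑-zero {n})
∑-single {suc n} (suc j) =
  trans (∑-cong (λ k → cong (if_then 1 else 0) (⌊⌋-map′ _ _ (j ≟ k)))) (∑-single j)

suc-∑-zero≡∑-single : (j : Fin n) → suc (∑ {n} (λ _ → 0)) ≡ ∑ (λ k → if j == k then 1 else 0)
suc-∑-zero≡∑-single {n} j = trans (cong suc (∑-zero {n})) (sym (∑-single j))

consumed produced : Transition n → Marking n
consumed tr x = if pre tr x then 1 else 0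
produced tr x = if post tr x then 1 else 0

record IsAdditive (L : Marking n → ℕ) : Set where
  field
    resp     : ∀ {f g} → f ≗ g → L f ≡ L g
    additive : ∀ f g → L (λ x → f x + g x) ≡ L f + L g

open IsAdditive

evaluation-additive : (x : Place n) → IsAdditive (λ f → f x)
evaluation-additive x = record { resp = λ f≗g → f≗g x ; additive = λ _ _ → refl }

infixl 6 _⊕_

_⊕_ : IsAdditive L → IsAdditive R → IsAdditive (λ f → L f + R f)
_⊕_ {L = L} {R = R} A B = record
  { resp     = λ f≗g → cong₂ _+_ (resp A f≗g) (resp B f≗g)
  ; additive = λ f g → trans (cong₂ _+_ (additive A f g) (additive B f g))
                             (interchange (L f) (L g) (R f) (R g))
  }

∑-additive : {L : Fin n → Marking n → ℕ} → (∀ j → IsAdditive (L j)) →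
             IsAdditive (λ f → ∑ (λ j → L j f))
∑-additive {L = L} A = record
  { resp     = λ f≗g → ∑-cong (λ j → resp (A j) f≗g)
  ; additive = λ f g → trans (∑-cong (λ j → additive (A j) f g)) (∑-+ (λ j → L j f) (λ j → L j g))
  }

-- Enabledness is exactly what makes the truncated subtraction in `fire` harmless.
module Firing {n} (m : Marking n) (tr : Transition n) (en : Enabled m tr) where

  consumed≤ : ∀ x → consumed tr x ≤ m x
  consumed≤ x with pre tr x | en x
  ... | true  | h = h refl
  ... | false | _ = z≤n

  fire-balance : ∀ x → fire m tr x + consumed tr x ≡ m x + produced tr x
  fire-balance x = begin
    m x ∸ c + e + c  ≡⟨ xy∙z≈xz∙y (m x ∸ c) e c ⟩
    m x ∸ c + c + e  ≡⟨ cong (_+ e) (m∸n+n≡m (consumed≤ x)) ⟩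
    m x + e          ∎
    where
    open ≡-Reasoning
    c e : ℕ
    c = consumed tr x
    e = produced tr x

  fire-additive : IsAdditive L → L (fire m tr) + L (consumed tr) ≡ L m + L (produced tr)
  fire-additive {L = L} A = begin
    L (fire m tr) + L (consumed tr)        ≡⟨ sym (additive A (fire m tr) (consumed tr)) ⟩
    L (λ x → fire m tr x + consumed tr x)  ≡⟨ resp A fire-balance ⟩
    L (λ x → m x + produced tr x)          ≡⟨ additive A m (produced tr) ⟩
    L m + L (produced tr)                  ∎
    where open ≡-Reasoning

  fire-conserves : IsAdditive L → L (consumed tr) ≡ L (produced tr) → L (fire m tr) ≡ L m
  fire-conserves {L = L} A c≡p =
    +-cancelʳ-≡ (L (produced tr)) (L (fire m tr)) (L m)
      (trans (cong (L (fire m tr) +_) (sym c≡p)) (fire-additive A))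

  -- The balance hypothesis is L(produced) − L(consumed) = R(produced) − R(consumed) without subtraction.
  fire-preserves-≡ : IsAdditive L → IsAdditive R →
                     R (produced tr) + L (consumed tr) ≡ R (consumed tr) + L (produced tr) →
                     L m ≡ R m → L (fire m tr) ≡ R (fire m tr)
  fire-preserves-≡ {L = L} {R = R} A B balanced Lm≡Rm =
    +-cancelʳ-≡ (R (produced tr) + L (consumed tr)) (L (fire m tr)) (R (fire m tr)) (begin
      L m′ + (Rp + Lc)        ≡⟨ x∙yz≈y∙xz (L m′) Rp Lc ⟩
      Rp + (L m′ + Lc)        ≡⟨ cong (Rp +_) (fire-additive A) ⟩
      Rp + (L m + Lp)         ≡⟨ x∙yz≈yx∙z Rp (L m) Lp ⟩
      L m + Rp + Lp           ≡⟨ cong (λ k → k + Rp + Lp) Lm≡Rm ⟩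
      R m + Rp + Lp           ≡⟨ cong (_+ Lp) (fire-additive B) ⟨
      R m′ + Rc + Lp          ≡⟨ +-assoc (R m′) Rc Lp ⟩
      R m′ + (Rc + Lp)        ≡⟨ cong (R m′ +_) balanced ⟨
      R m′ + (Rp + Lc)        ∎)
    where
    open ≡-Reasoning
    m′ : Marking n
    m′ = fire m tr
    Lc Lp Rc Rp : ℕ
    Lc = L (consumed tr)
    Lp = L (produced tr)
    Rc = R (consumed tr)
    Rp = R (produced tr)

serverState : Marking n → ℕ
serverState f = f i + f p + f q + f r

clientState : Fin n → Marking n → ℕ
clientState j f = f (iₓ j) + f (pₓ j) + f (qₓ j) + f (rₓ j)

waitingClients : Marking n → ℕ
waitingClients f = ∑ (λ j → f (pₓ j))

openRequests : Marking n → ℕ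
openRequests f = f a₁ + f p + f a₂

openReplies : Marking n → ℕ
openReplies f = f a₂ + f a₃ + ∑ (λ k → f (qₓ k))

serverState-additive : IsAdditive (serverState {n})
serverState-additive =
  evaluation-additive i ⊕ evaluation-additive p ⊕ evaluation-additive q ⊕ evaluation-additive r

clientState-additive : (j : Fin n) → IsAdditive (clientState j)
clientState-additive j =
  evaluation-additive (iₓ j) ⊕ evaluation-additive (pₓ j) ⊕
  evaluation-additive (qₓ j) ⊕ evaluation-additive (rₓ j)

waitingClients-additive : IsAdditive (waitingClients {n})
waitingClients-additive = ∑-additive (λ j → evaluation-additive (pₓ j))

openRequests-additive : IsAdditive (openRequests {n})
openRequests-additive = evaluation-additive a₁ ⊕ evaluation-additive p ⊕ evaluation-additive a₂

openReplies-additive : IsAdditive (openReplies {n})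
openReplies-additive =
  evaluation-additive a₂ ⊕ evaluation-additive a₃ ⊕ ∑-additive (λ k → evaluation-additive (qₓ k))

serverState-conserved : (tr : Transition n) → serverState (consumed tr) ≡ serverState (produced tr)
serverState-conserved u      = refl
serverState-conserved v      = refl
serverState-conserved w      = refl
serverState-conserved t      = refl
serverState-conserved (uₓ j) = refl
serverState-conserved (vₓ j) = refl
serverState-conserved (wₓ j) = refl

clientState-conserved : (k : Fin n) (tr : Transition n) →
                        clientState k (consumed tr) ≡ clientState k (produced tr)
clientState-conserved k u      = refl
clientState-conserved k v      = refl
clientState-conserved k w      = refl
clientState-conserved k t      = refl
clientState-conserved k (uₓ j) = +-identityʳ _
clientState-conserved k (vₓ j) = +-identityʳ _
clientState-conserved k (wₓ j) = +-identityʳ _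

requests-balanced : (tr : Transition n) →
  openRequests (produced tr) + waitingClients (consumed tr) ≡
  openRequests (consumed tr) + waitingClients (produced tr)
requests-balanced u      = refl
requests-balanced v      = refl
requests-balanced w      = refl
requests-balanced t      = refl
requests-balanced (uₓ j) = suc-∑-zero≡∑-single j
requests-balanced (vₓ j) = sym (suc-∑-zero≡∑-single j)
requests-balanced (wₓ j) = refl

replies-balanced : (tr : Transition n) →
  produced tr q + openReplies (consumed tr) ≡ consumed tr q + openReplies (produced tr)
replies-balanced u      = refl
replies-balanced v      = refl
replies-balanced w      = refl
replies-balanced t      = refl
replies-balanced (uₓ j) = refl
replies-balanced (vₓ j) = suc-∑-zero≡∑-single j
replies-balanced (wₓ j) = sym (suc-∑-zero≡∑-single j)

equations⇒Inv : serverState m ≡ 1 → (∀ j → clientState j m ≡ 1) →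
                waitingClients m ≡ openRequests m → openReplies m ≡ m q → Inv m
equations⇒Inv {m = m} server≡1 client≡1 waiting≡open replies≡q = record
  { inv1  = server≡1
  ; inv2  = client≡1
  ; inv3  = waiting≡open
  ; inv4  = begin
      ∑q + m a₂           ≡⟨ +-comm ∑q (m a₂) ⟩
      m a₂ + ∑q           ≤⟨ +-monoˡ-≤ ∑q (m≤m+n (m a₂) (m a₃)) ⟩
      openReplies m       ≤⟨ replies≤1 ⟩
      1                   ∎
  ; inv5a = ≤-trans (m≤m+n (m a₂ + m a₃) ∑q) replies≤1
  ; inv5b = replies≡q
  }
  where
  open ≤-Reasoning
  ∑q : ℕ
  ∑q = ∑ (λ k → m (qₓ k))
  replies≤1 : openReplies m ≤ 1
  replies≤1 = begin
    openReplies m         ≡⟨ replies≡q ⟩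
    m q                   ≤⟨ m≤n+m (m q) (m i + m p) ⟩
    m i + m p + m q       ≤⟨ m≤m+n (m i + m p + m q) (m r) ⟩
    serverState m         ≡⟨ server≡1 ⟩
    1                     ∎

lemma7 : (n : ℕ) (m : Marking n) → Inv m →
    (tr : Transition n) → Enabled m tr → Inv (fire m tr)
lemma7 n m I tr en = equations⇒Inv
  (trans (fire-conserves serverState-additive (serverState-conserved tr)) inv1)
  (λ j → trans (fire-conserves (clientState-additive j) (clientState-conserved j tr)) (inv2 j))
  (fire-preserves-≡ waitingClients-additive openRequests-additive (requests-balanced tr) inv3)
  (fire-preserves-≡ openReplies-additive (evaluation-additive q) (replies-balanced tr) inv5b)
  where
  open Inv I
  open Firing m tr en
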